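{- On the set $\Lambda_u$ of $\mathrm{SKI}_u$ terms, (strong) bisimilarity $\sim$ of the transition system defined below is a congruence: for every operation symbol $f$ of arity $n$ and all terms with $p_i\sim q_i$ ($i=1,\dots,n$), one has $f(p_1,\dots,p_n)\sim f(q_1,\dots,q_n)$.
   Context: $\Lambda_u$ is the set of closed terms generated by the grammar $\Lambda_u ::= S\mid K\mid I\mid \Lambda_u\circ\Lambda_u\mid S'(\Lambda_u)\mid K'(\Lambda_u)\mid S''(\Lambda_u,\Lambda_u)$; we write $p\,q$ for $p\circ q$. The transition relation consists of unlabelled transitions $p\to p'$ and labelled transitions $p\xrightarrow{t}p'$ with labels $t\in\Lambda_u$, inductively generated by the rules: $S\xrightarrow{t}S'(t)$; $S'(p)\xrightarrow{t}S''(p,t)$; $S''(p,q)\xrightarrow{t}(p\,t)\,(q\,t)$; $K\xrightarrow{t}K'(t)$; $K'(p)\xrightarrow{t}p$; $I\xrightarrow{t}t$; if $p\to p'$ then $p\,q\to p'\,q$; if $p\xrightarrow{q}p'$ then $p\,q\to p'$ (for all $t,p,p',q\in\Lambda_u$). A relation $R\subseteq\Lambda_u\times\Lambda_u$ is a bisimulation if whenever $p\,R\,q$: (1) $p\to p'$ implies $q\to q'$ for some $q'$ with $p'\,R\,q'$; (2) $q\to q'$ implies $p\to p'$ for some $p'$ with $p'\,R\,q'$; (3) for all $t$, $p\xrightarrow{t}p'$ implies $q\xrightarrow{t}q'$ for some $q'$ with $p'\,R\,q'$; (4) for all $t$, $q\xrightarrow{t}q'$ implies $p\xrightarrow{t}p'$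 for some $p'$ with $p'\,R\,q'$. Bisimilarity $\sim$ is the greatest bisimulation. -}

module Defs where

open import Level using (0ℓ; suc)
open import Data.Product using (Σ; _×_; ∃)
open import Relation.Binary using (Rel)

data Λu : Set where
  S K I : Λu
  _∘_ : Λu → Λu → Λu
  S′ K′ : Λu → Λu
  S″ : Λu → Λu → Λu

infixl 5 _∘_

data _⟶_ : Λu → Λu → Set
data _—[_]→_ : Λu → Λu → Λu → Set

data _—[_]→_ where
  S-step  : ∀ t → S —[ t ]→ S′ t
  S′-step : ∀ p t → S′ p —[ t ]→ S″ p t
  S″-step : ∀ p q t → S″ p q —[ t ]→ ((p ∘ t) ∘ (q ∘ t))
  K-step  : ∀ t → K —[ t ]→ K′ t
  K′-step : ∀ p t → K′ p —[ t ]→ p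
  I-step  : ∀ t → I —[ t ]→ t

data _⟶_ where
  app-left : ∀ {p p′} q → p ⟶ p′ → (p ∘ q) ⟶ (p′ ∘ q)
  app-lab  : ∀ {p p′ q} → p —[ q ]→ p′ → (p ∘ q) ⟶ p′

IsBisimulation : Rel Λu 0ℓ → Set
IsBisimulation R = ∀ {p q} → R p q →
  (∀ {p′} → p ⟶ p′ → ∃ λ q′ → q ⟶ q′ × R p′ q′) ×
  (∀ {q′} → q ⟶ q′ → ∃ λ p′ → p ⟶ p′ × R p′ q′) ×
  (∀ {t p′} → p —[ t ]→ p′ → ∃ λ q′ → q —[ t ]→ q′ × R p′ q′) ×
  (∀ {t q′} → q —[ t ]→ q′ → ∃ λ p′ → p —[ t ]→ p′ × R p′ q′)

_∼_ : Λu → Λu → Set₁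
p ∼ q = Σ (Rel Λu 0ℓ) λ R → IsBisimulation R × R p q

infix 4 _∼_

{-# OPTIONS --safe #-}
-- The closure of a bisimulation B under the term formers, reflexivity and
-- transitivity is again a bisimulation, and it relates the composite terms built
-- from B-related arguments.  Transitivity is essential: a labelled step
-- p —[ t ]→ p′ has to be matched for a label t′ that is only related to t, so it
-- is first replayed on p itself with label t′ (the combinators use their label
-- only inside term formers) and then transferred along B.
module Submission where

open import Defs
open import Data.Product using (_×_; _,_; ∃)
open import Data.Sum using (inj₁; inj₂)
open import Function using (flip)
open import Level using (0ℓ)
open import Relation.Binary using (Rel; _⇒_)
open import Relation.Binary.Construct.Union using (_∪_)

Progresses : Rel Λu 0ℓ → Λu → Λu → Set
Progresses R p q =
  (∀ {p′} → p ⟶ p′ → ∃ λ q′ → q ⟶ q′ × R p′ q′) ×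
  (∀ {q′} → q ⟶ q′ → ∃ λ p′ → p ⟶ p′ × R p′ q′) ×
  (∀ {t p′} → p —[ t ]→ p′ → ∃ λ q′ → q —[ t ]→ q′ × R p′ q′) ×
  (∀ {t q′} → q —[ t ]→ q′ → ∃ λ p′ → p —[ t ]→ p′ × R p′ q′)

Progresses-mono : ∀ {R R′ p q} → R ⇒ R′ → Progresses R p q → Progresses R′ p q
Progresses-mono f (fwd , bwd , fwd-lab , bwd-lab) =
  (λ s → let q′ , s′ , r = fwd s in q′ , s′ , f r) ,
  (λ s → let p′ , s′ , r = bwd s in p′ , s′ , f r) ,
  (λ s → let q′ , s′ , r = fwd-lab s in q′ , s′ , f r) ,
  (λ s → let p′ , s′ , r = bwd-lab s in p′ , s′ , f r)

∪-isBisimulation : ∀ {R₁ R₂} → IsBisimulation R₁ → IsBisimulation R₂ →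
                   IsBisimulation (R₁ ∪ R₂)
∪-isBisimulation bis₁ bis₂ (inj₁ r) = Progresses-mono inj₁ (bis₁ r)
∪-isBisimulation bis₁ bis₂ (inj₂ r) = Progresses-mono inj₂ (bis₂ r)

flip-isBisimulation : ∀ {R} → IsBisimulation R → IsBisimulation (flip R)
flip-isBisimulation bis r = let fwd , bwd , fwd-lab , bwd-lab = bis r in bwd , fwd , bwd-lab , fwd-lab

data CongClosure (B : Rel Λu 0ℓ) : Rel Λu 0ℓ where
  base   : ∀ {p q} → B p q → CongClosure B p q
  refl   : ∀ {p} → CongClosure B p p
  trans  : ∀ {p r q} → CongClosure B p r → CongClosure B r q → CongClosure B p q
  ∘-cong : ∀ {p₁ p₂ q₁ q₂} → CongClosure B p₁ q₁ → CongClosure B p₂ q₂ →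
           CongClosure B (p₁ ∘ p₂) (q₁ ∘ q₂)
  S′-cong : ∀ {p q} → CongClosure B p q → CongClosure B (S′ p) (S′ q)
  K′-cong : ∀ {p q} → CongClosure B p q → CongClosure B (K′ p) (K′ q)
  S″-cong : ∀ {p₁ p₂ q₁ q₂} → CongClosure B p₁ q₁ → CongClosure B p₂ q₂ →
            CongClosure B (S″ p₁ p₂) (S″ q₁ q₂)

module _ {B : Rel Λu 0ℓ} where

  CongClosure-flip : ∀ {p q} → CongClosure B p q → CongClosure (flip B) q p
  CongClosure-flip (base b)      = base b
  CongClosure-flip refl          = refl
  CongClosure-flip (trans c d)   = trans (CongClosure-flip d) (CongClosure-flip c)
  CongClosure-flip (∘-cong c d)  = ∘-cong (CongClosure-flip c) (CongClosure-flip d)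
  CongClosure-flip (S′-cong c)   = S′-cong (CongClosure-flip c)
  CongClosure-flip (K′-cong c)   = K′-cong (CongClosure-flip c)
  CongClosure-flip (S″-cong c d) = S″-cong (CongClosure-flip c) (CongClosure-flip d)

  relabel : ∀ {p t t′ p′} → p —[ t ]→ p′ → CongClosure B t t′ →
            ∃ λ p″ → p —[ t′ ]→ p″ × CongClosure B p′ p″
  relabel (S-step _)      c = _ , S-step _ , S′-cong c
  relabel (S′-step p _)   c = _ , S′-step p _ , S″-cong refl c
  relabel (S″-step p q _) c = _ , S″-step p q _ , ∘-cong (∘-cong refl c) (∘-cong refl c)
  relabel (K-step _)      c = _ , K-step _ , K′-cong c
  relabel (K′-step p _)   c = _ , K′-step p _ , refl
  relabel (I-step _)      c = _ , I-step _ , c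

  module _ (bis : IsBisimulation B) where

    simulate-—[]→ : ∀ {p q t t′ p′} → CongClosure B p q → p —[ t ]→ p′ → CongClosure B t t′ →
                    ∃ λ q′ → q —[ t′ ]→ q′ × CongClosure B p′ q′
    simulate-—[]→ (base b) s c =
      let _ , s′ , c′ = relabel s c
          _ , _ , match , _ = bis b
          q′ , s″ , b′ = match s′
      in q′ , s″ , trans c′ (base b′)
    simulate-—[]→ refl s c = relabel s c
    simulate-—[]→ (trans d e) s c =
      let _ , s′ , d′ = simulate-—[]→ d s c
          q′ , s″ , e′ = simulate-—[]→ e s′ refl
      in q′ , s″ , trans d′ e′
    simulate-—[]→ (∘-cong _ _) () _
    simulate-—[]→ (S′-cong d)   (S′-step _ _)   c = _ , S′-step _ _ , S″-cong d c
    simulate-—[]→ (K′-cong d)   (K′-step _ _)   c = _ , K′-step _ _ , d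
    simulate-—[]→ (S″-cong d e) (S″-step _ _ _) c = _ , S″-step _ _ _ , ∘-cong (∘-cong d c) (∘-cong e c)

    simulate-⟶ : ∀ {p q p′} → CongClosure B p q → p ⟶ p′ →
                 ∃ λ q′ → q ⟶ q′ × CongClosure B p′ q′
    simulate-⟶ (base b) s =
      let match , _ = bis b
          q′ , s′ , b′ = match s
      in q′ , s′ , base b′
    simulate-⟶ refl s = _ , s , refl
    simulate-⟶ (trans d e) s =
      let _ , s′ , d′ = simulate-⟶ d s
          q′ , s″ , e′ = simulate-⟶ e s′
      in q′ , s″ , trans d′ e′
    simulate-⟶ (∘-cong d e) (app-left _ s) =
      let q′ , s′ , d′ = simulate-⟶ d s in _ , app-left _ s′ , ∘-cong d′ e
    simulate-⟶ (∘-cong d e) (app-lab s) =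
      let q′ , s′ , d′ = simulate-—[]→ d s e in q′ , app-lab s′ , d′
    simulate-⟶ (S′-cong _) ()
    simulate-⟶ (K′-cong _) ()
    simulate-⟶ (S″-cong _ _) ()

CongClosure-isBisimulation : ∀ {B} → IsBisimulation B → IsBisimulation (CongClosure B)
CongClosure-isBisimulation bis c =
  simulate-⟶ bis c ,
  (λ s → let p′ , s′ , c′ = simulate-⟶ bis⁻¹ (CongClosure-flip c) s in p′ , s′ , CongClosure-flip c′) ,
  (λ s → simulate-—[]→ bis c s refl) ,
  (λ s → let p′ , s′ , c′ = simulate-—[]→ bis⁻¹ (CongClosure-flip c) s refl in p′ , s′ , CongClosure-flip c′)
  where bis⁻¹ = flip-isBisimulation bis

CongClosure⇒∼ : ∀ {B p q} → IsBisimulation B → CongClosure B p q → p ∼ q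
CongClosure⇒∼ bis c = CongClosure _ , CongClosure-isBisimulation bis , c

proposition3p2 :
    (∀ {p₁ p₂ q₁ q₂} → p₁ ∼ q₁ → p₂ ∼ q₂ → (p₁ ∘ p₂) ∼ (q₁ ∘ q₂)) ×
    (∀ {p q} → p ∼ q → S′ p ∼ S′ q) ×
    (∀ {p q} → p ∼ q → K′ p ∼ K′ q) ×
    (∀ {p₁ p₂ q₁ q₂} → p₁ ∼ q₁ → p₂ ∼ q₂ → S″ p₁ p₂ ∼ S″ q₁ q₂)
proposition3p2 =
  (λ { (_ , bis₁ , r₁) (_ , bis₂ , r₂) →
         CongClosure⇒∼ (∪-isBisimulation bis₁ bis₂) (∘-cong (base (inj₁ r₁)) (base (inj₂ r₂))) }) ,
  (λ { (_ , bis , r) → CongClosure⇒∼ bis (S′-cong (base r)) }) ,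
  (λ { (_ , bis , r) → CongClosure⇒∼ bis (K′-cong (base r)) }) ,
  (λ { (_ , bis₁ , r₁) (_ , bis₂ , r₂) →
         CongClosure⇒∼ (∪-isBisimulation bis₁ bis₂) (S″-cong (base (inj₁ r₁)) (base (inj₂ r₂))) })
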